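{- Assume that for every integer $e\ge 0$ and every integer $k$ with $0\le k<2^e$, $$\nu\bigl(f(2^e+k)-f(k)\bigr)\ge e-2\alpha(k)-2.$$ Let $x\in\mathbb{Z}_2$, and for $j\ge 1$ let $x_j$ be the mod $2^j$ reduction of $x$, regarded as a string of $j$ binary digits (leading zeros included). If (number of 0's in $x_j$) $-$ (number of 1's in $x_j$) tends to $\infty$ as $j\to\infty$, then $f(x)$ is 2-definable.
   Context: For $n\in\mathbb{N}$ (natural numbers including $0$), $f(n)=\sum_{k=0}^n\binom nk^{ -1}\in\mathbb{Q}\subset\mathbb{Q}_2$. $\nu(-)$ denotes the exponent of $2$ in a rational number (the 2-adic valuation, with $\nu(0)=\infty$). $\alpha(n)$ denotes the number of 1's in the binary expansion of $n$. For $x\in\mathbb{Z}_2$ with $x_j$ its mod $2^j$ reduction (an integer in $[0,2^j)$), $f(x)$ is called 2-definable if the sequence $\langle f(x_j)\rangle$ is a Cauchy sequence in $\mathbb{Q}_2$ (with the 2-adic metric $d(x,y)=2^{ -\nu(x-y)}$). -}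

module Defs where

open import Data.Bool using (Bool; true; false; if_then_else_)
open import Data.Nat as ℕ using (ℕ; zero; suc; _%_; ⌊_/2⌋; _^_)
open import Data.Nat.Combinatorics using (_C_)
open import Data.Integer as ℤ using (ℤ; +_)
open import Data.Rational as ℚ using (ℚ; 0ℚ; _+_; _/_)
open import Data.List using (List; map; foldr; upTo)

-- 2-adic valuation of a natural number (ν₂ 0 = 0 by convention; only used
-- on nonzero arguments). The first argument is fuel (n suffices).
ν₂-go : ℕ → ℕ → ℕ
ν₂-go zero    n = 0
ν₂-go (suc f) zero = 0
ν₂-go (suc f) (suc m) with suc m % 2
... | zero  = suc (ν₂-go f ⌊ suc m /2⌋)
... | suc _ = 0

ν₂ℕ : ℕ → ℕ
ν₂ℕ n = ν₂-go n n

-- integers extended with +∞ (for ν(0) = ∞)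
data ℤ∞ : Set where
  fin : ℤ → ℤ∞
  ∞   : ℤ∞

infix 4 _≤∞_
data _≤∞_ : ℤ∞ → ℤ∞ → Set where
  fin≤fin : ∀ {a b} → a ℤ.≤ b → fin a ≤∞ fin b
  _≤∞∞    : ∀ a → a ≤∞ ∞

ν : ℚ → ℤ∞
ν q with ℚ.numerator q
... | + zero = ∞
... | n      = fin (+ ν₂ℕ ℤ.∣ n ∣ ℤ.- + ν₂ℕ (ℚ.denominatorℕ q))

-- reciprocal of a natural number as a rational (only applied to nonzero
-- values: binomial coefficients C(n,k) with k ≤ n)
inv : ℕ → ℚ
inv zero    = 0ℚ
inv (suc m) = + 1 / suc m

sumℚ : List ℚ → ℚ
sumℚ = foldr _+_ 0ℚ

f : ℕ → ℚ
f n = sumℚ (map (λ k → inv (n C k)) (upTo (suc n)))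

α-go : ℕ → ℕ → ℕ
α-go zero    n = 0
α-go (suc f) n = n % 2 ℕ.+ α-go f ⌊ n /2⌋

α : ℕ → ℕ
α n = α-go n n

-- A 2-adic integer x is given by its binary digits: x i = digit of 2^i.
ℤ₂ : Set
ℤ₂ = ℕ → Bool

reduce : ℤ₂ → ℕ → ℕ
reduce x zero    = 0
reduce x (suc j) = reduce x j ℕ.+ (if x j then 2 ^ j else 0)

ones : ℤ₂ → ℕ → ℕ
ones x zero    = 0
ones x (suc j) = ones x j ℕ.+ (if x j then 1 else 0)

zeros : ℤ₂ → ℕ → ℕ
zeros x zero    = 0
zeros x (suc j) = zeros x j ℕ.+ (if x j then 0 else 1)

module Submission where

-- Write F(j) = f(x_j). The proof rests on two observations.
--
-- 1. The rationals q with ν(q) ≥ M are exactly the fractions 2^M·t/s with s odd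
--    (Mult₂ below), and these are closed under addition: ν is an ultrametric
--    valuation. By telescoping, F is 2-adically Cauchy as soon as, for every M,
--    the increments F(j+1) − F(j) eventually have valuation ≥ M.
-- 2. If digit j of x is 0 then x_{j+1} = x_j and the increment vanishes; if it is 1
--    then x_{j+1} = 2^j + x_j with x_j < 2^j, so the hypothesis bounds the
--    valuation of the increment below by j − 2α(x_j) − 2, which is at least
--    (#0's − #1's among the first j digits) − 2, because α(x_j) ≤ #1's and
--    j = #0's + #1's. This tends to ∞ by assumption.

open import Defs
open import Data.Nat using (ℕ; _≤_; _<_; _^_; _*_)
open import Data.Nat as ℕ using ()
open import Data.Integer as ℤ using (+_)
open import Data.Rational using (_-_)
open import Data.Product using (∃-syntax)

open import Data.Bool using (Bool; true; false; if_then_else_)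
open import Data.Nat using (zero; suc; _+_; _∸_; _%_; ⌊_/2⌋; z≤n; s≤s; s≤s⁻¹; z<s)
open import Data.Nat.Properties
open import Data.Nat.Divisibility
  using (_∣_; divides; _∣0; ∣-trans; m∣m*n; n∣m*n; *-cancelˡ-∣; n∣m⇒m%n≡0)
open import Data.Nat.Primality using (prime; 2-rough; euclidsLemma)
open import Data.Nat.Coprimality using (Coprime; recompute)
import Data.Nat.Tactic.RingSolver as ℕSolver
open import Data.Integer using (-[1+_]; +≤+)
import Data.Integer.Properties as ℤP
import Data.Integer.Tactic.RingSolver as ℤSolver
open import Data.Rational as ℚ using (ℚ; mkℚ; toℚᵘ; 0ℚ)
import Data.Rational.Properties as ℚP
open import Data.Rational.Unnormalised using (mkℚᵘ; *≡*) renaming (_≃_ to _≃ᵘ_)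
import Data.Rational.Unnormalised.Properties as ℚᵘP
open import Algebra.Properties.AbelianGroup ℚP.+-0-abelianGroup using (⁻¹-anti-homo‿-)
open import Data.Product using (_×_; _,_; proj₁; proj₂)
open import Data.Sum using (inj₁; inj₂)
open import Relation.Nullary using (¬_; contradiction)
open import Relation.Binary.PropositionalEquality

-- Odd numbers and the 2-adic valuation of natural numbers

Odd : ℕ → Set
Odd n = ¬ (2 ∣ n)

%2≢0⇒odd : ∀ n → n % 2 ≢ 0 → Odd n
%2≢0⇒odd n rem≢0 2∣n = rem≢0 (n∣m⇒m%n≡0 n 2 2∣n)

%2≡0⇒twice-half : ∀ n → n % 2 ≡ 0 → n ≡ 2 * ⌊ n /2⌋
%2≡0⇒twice-half zero          _   = refl
%2≡0⇒twice-half (suc (suc n)) rem =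
  trans (cong (λ m → 2 + m) (%2≡0⇒twice-half n rem)) (sym (*-suc 2 ⌊ n /2⌋))

odd-* : ∀ {a b} → Odd a → Odd b → Odd (a * b)
odd-* {a} {b} odd-a odd-b 2∣ab with euclidsLemma a b (prime 2-rough) 2∣ab
... | inj₁ 2∣a = odd-a 2∣a
... | inj₂ 2∣b = odd-b 2∣b

pow2-mono-∣ : ∀ {k v} → k ≤ v → 2 ^ k ∣ 2 ^ v
pow2-mono-∣ {k} {v} k≤v = divides (2 ^ (v ∸ k)) (begin
  2 ^ v                 ≡⟨ cong (2 ^_) (sym (m∸n+n≡m k≤v)) ⟩
  2 ^ (v ∸ k + k)       ≡⟨ ^-distribˡ-+-* 2 (v ∸ k) k ⟩
  2 ^ (v ∸ k) * 2 ^ k   ∎)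
  where open ≡-Reasoning

-- ν₂ splits off the largest power of 2: a positive n is 2^(ν₂ n)·o with o odd.
-- Stated for the fuelled ν₂-go; any fuel ≥ n gives the same answer.
ν₂-go-split : ∀ fuel n → n ≤ fuel → 0 < n → ∃[ o ] (Odd o × n ≡ 2 ^ ν₂-go fuel n * o)
ν₂-go-split zero       (suc _) () _
ν₂-go-split (suc fuel) (suc m) n≤fuel _ with suc m % 2 in rem
... | suc _ = suc m , %2≢0⇒odd (suc m) (λ rem≡0 → 0≢1+n (trans (sym rem≡0) rem)) ,
              sym (*-identityˡ (suc m))
... | zero  = o , odd-o , (begin
  suc m                       ≡⟨ n≡2h ⟩
  2 * h                       ≡⟨ cong (2 *_) h≡ ⟩
  2 * (2 ^ ν₂-go fuel h * o)  ≡⟨ sym (*-assoc 2 (2 ^ ν₂-go fuel h) o) ⟩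
  2 ^ suc (ν₂-go fuel h) * o  ∎)
  where
  open ≡-Reasoning
  h = ⌊ suc m /2⌋
  n≡2h : suc m ≡ 2 * h
  n≡2h = %2≡0⇒twice-half (suc m) rem
  h≤fuel : h ≤ fuel
  h≤fuel = s≤s⁻¹ (≤-trans (⌊n/2⌋<n m) n≤fuel)
  h>0 : 0 < h
  h>0 = n≢0⇒n>0 (λ h≡0 → 1+n≢0 (trans n≡2h (cong (2 *_) h≡0)))
  split-h = ν₂-go-split fuel h h≤fuel h>0
  o = proj₁ split-h
  odd-o = proj₁ (proj₂ split-h)
  h≡ = proj₂ (proj₂ split-h)

ν₂-split : ∀ n → 0 < n → ∃[ o ] (Odd o × n ≡ 2 ^ ν₂ℕ n * o)
ν₂-split n = ν₂-go-split n n ≤-refl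

-- 2^k ∣ 2^v·o with o odd forces k ≤ v: cancel 2's until the odd factor would be even.
pow2∣pow2*odd⇒≤ : ∀ k v {o} → Odd o → 2 ^ k ∣ 2 ^ v * o → k ≤ v
pow2∣pow2*odd⇒≤ zero    _       _     _ = z≤n
pow2∣pow2*odd⇒≤ (suc k) zero    {o} odd-o d =
  contradiction (∣-trans (m∣m*n (2 ^ k)) (subst (2 ^ suc k ∣_) (*-identityˡ o) d)) odd-o
pow2∣pow2*odd⇒≤ (suc k) (suc v) {o} odd-o d =
  s≤s (pow2∣pow2*odd⇒≤ k v odd-o (*-cancelˡ-∣ 2 (subst (2 ^ suc k ∣_) (*-assoc 2 (2 ^ v) o) d)))

pow2∣⇒≤ν₂ : ∀ k n → 0 < n → 2 ^ k ∣ n → k ≤ ν₂ℕ n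
pow2∣⇒≤ν₂ k n n>0 d with ν₂-split n n>0
... | o , odd-o , n≡ = pow2∣pow2*odd⇒≤ k (ν₂ℕ n) odd-o (subst (2 ^ k ∣_) n≡ d)

≤ν₂⇒pow2∣ : ∀ k n → 0 < n → k ≤ ν₂ℕ n → 2 ^ k ∣ n
≤ν₂⇒pow2∣ k n n>0 k≤ν with ν₂-split n n>0
... | o , _ , n≡ = subst (2 ^ k ∣_) (sym n≡) (∣-trans (pow2-mono-∣ k≤ν) (m∣m*n o))

ν₂≡0⇒odd : ∀ n → 0 < n → ν₂ℕ n ≡ 0 → Odd n
ν₂≡0⇒odd n n>0 ν≡0 with ν₂-split n n>0
... | o , odd-o , n≡ = subst Odd (sym (trans n≡ (trans (cong (λ v → 2 ^ v * o) ν≡0) (*-identityˡ o)))) odd-o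

odd⇒ν₂≡0 : ∀ n → 0 < n → Odd n → ν₂ℕ n ≡ 0
odd⇒ν₂≡0 n n>0 odd-n with ν₂ℕ n in ν≡
... | zero  = refl
... | suc _ = contradiction (≤ν₂⇒pow2∣ 1 n n>0 (subst (1 ≤_) (sym ν≡) (s≤s z≤n))) odd-n

pow2∣-cancel-odd : ∀ k a {s} → Odd s → 2 ^ k ∣ a * s → 2 ^ k ∣ a
pow2∣-cancel-odd k zero    _     _ = (2 ^ k) ∣0
pow2∣-cancel-odd k (suc a) {s} odd-s d with ν₂-split (suc a) z<s
... | o , odd-o , a≡ = ≤ν₂⇒pow2∣ k (suc a) z<s (pow2∣pow2*odd⇒≤ k _ (odd-* odd-o odd-s)
       (subst (2 ^ k ∣_) (trans (cong (_* s) a≡) (*-assoc (2 ^ ν₂ℕ (suc a)) o s)) d))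

-- The valuation of rationals: ν(q) ≥ M as 2-adic divisibility

-- M ≤ν q : the 2-adic valuation of q is at least M (always so for q = 0).
_≤ν_ : ℕ → ℚ → Set
M ≤ν q = fin (+ M) ≤∞ ν q

-- q is a 2-adic multiple of 2^M: q = 2^M·t / s for an integer t and an odd s
-- (the denominator mkℚᵘ _ s stands for 1 + s).
Mult₂ : ℕ → ℚ → Set
Mult₂ M q = ∃[ t ] ∃[ s ] (Odd (suc s) × toℚᵘ q ≃ᵘ mkℚᵘ (+ (2 ^ M) ℤ.* t) s)

coprime⇒¬both-even : ∀ {a d} → Coprime a d → ¬ (2 ∣ a × 2 ∣ d)
coprime⇒¬both-even coprime both with coprime both
... | ()

abs-cross : ∀ M n t s d → n ℤ.* + s ≡ + (2 ^ M) ℤ.* t ℤ.* + d →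
            ℤ.∣ n ∣ * s ≡ 2 ^ M * ℤ.∣ t ∣ * d
abs-cross M n t s d eq = begin
  ℤ.∣ n ∣ * s                       ≡⟨ sym (ℤP.abs-* n (+ s)) ⟩
  ℤ.∣ n ℤ.* + s ∣                   ≡⟨ cong ℤ.∣_∣ eq ⟩
  ℤ.∣ + (2 ^ M) ℤ.* t ℤ.* + d ∣     ≡⟨ ℤP.abs-* (+ (2 ^ M) ℤ.* t) (+ d) ⟩
  ℤ.∣ + (2 ^ M) ℤ.* t ∣ * d         ≡⟨ cong (_* d) (ℤP.abs-* (+ (2 ^ M)) t) ⟩
  2 ^ M * ℤ.∣ t ∣ * d               ∎
  where open ≡-Reasoning

lowest-terms⇒odd-denominator : ∀ M {a d s} t → Coprime a d → Odd s →
  a * s ≡ 2 ^ M * ℤ.∣ t ∣ * d → Odd d × 2 ^ M ∣ a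
lowest-terms⇒odd-denominator M {a} {d} {s} t coprime odd-s as≡ =
  odd-d , pow2∣-cancel-odd M a odd-s 2^M∣as
  where
  2^M∣as : 2 ^ M ∣ a * s
  2^M∣as = subst (2 ^ M ∣_) (sym as≡) (∣-trans (m∣m*n ℤ.∣ t ∣) (m∣m*n d))
  odd-d : Odd d
  odd-d 2∣d = coprime⇒¬both-even coprime (pow2∣-cancel-odd 1 a odd-s 2∣as , 2∣d)
    where
    2∣as : 2 ∣ a * s
    2∣as = subst (2 ∣_) (sym as≡) (∣-trans 2∣d (n∣m*n (2 ^ M * ℤ.∣ t ∣)))

-- Conversely, a/d in lowest terms with ν₂ a − ν₂ d ≥ M has d odd and 2^M ∣ a:
-- a positive ν₂ d would make both a and d even.
valuation⇒odd-denominator : ∀ M {a d} → Coprime a d → 0 < a → 0 < d →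
  + M ℤ.≤ + ν₂ℕ a ℤ.- + ν₂ℕ d → Odd d × 2 ^ M ∣ a
valuation⇒odd-denominator M {a} {d} coprime a>0 d>0 M≤ with ν₂ℕ d in ν-d
... | zero  = ν₂≡0⇒odd d d>0 ν-d ,
              ≤ν₂⇒pow2∣ M a a>0 (subst (M ≤_) (+-identityʳ (ν₂ℕ a)) (ℤP.drop‿+≤+ M≤))
... | suc w = contradiction (2∣a , 2∣d) (coprime⇒¬both-even coprime)
  where
  2∣d : 2 ∣ d
  2∣d = ≤ν₂⇒pow2∣ 1 d d>0 (subst (1 ≤_) (sym ν-d) (s≤s z≤n))
  2∣a : 2 ∣ a
  2∣a = ≤ν₂⇒pow2∣ 1 a a>0 (≤-trans (s≤s z≤n)
          (ℤP.drop‿+≤+ (ℤP.0≤i-j⇒j≤i (ℤP.≤-trans (+≤+ z≤n) M≤))))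

odd-denominator⇒valuation : ∀ M {a d} → 0 < a → 0 < d → Odd d × 2 ^ M ∣ a →
  fin (+ M) ≤∞ fin (+ ν₂ℕ a ℤ.- + ν₂ℕ d)
odd-denominator⇒valuation M {a} {d} a>0 d>0 (odd-d , 2^M∣a)
  rewrite odd⇒ν₂≡0 d d>0 odd-d =
  fin≤fin (+≤+ (≤-trans (pow2∣⇒≤ν₂ M a a>0 2^M∣a) (m≤m+n (ν₂ℕ a) 0)))

Mult₂⇒≤ν : ∀ M q → Mult₂ M q → M ≤ν q
Mult₂⇒≤ν M (mkℚ (+ zero)  _ _) _ = fin (+ M) ≤∞∞
Mult₂⇒≤ν M (mkℚ n@(+ suc a) d c) (t , s , odd-s , *≡* eq) =
  odd-denominator⇒valuation M z<s z<s
    (lowest-terms⇒odd-denominator M t (recompute c) odd-s (abs-cross M n t (suc s) (suc d) eq))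
Mult₂⇒≤ν M (mkℚ n@(-[1+ a ]) d c) (t , s , odd-s , *≡* eq) =
  odd-denominator⇒valuation M z<s z<s
    (lowest-terms⇒odd-denominator M t (recompute c) odd-s (abs-cross M n t (suc s) (suc d) eq))

numerator-multiple : ∀ M {n d} .{c : Coprime ℤ.∣ n ∣ (suc d)} t →
  Odd (suc d) → n ≡ + (2 ^ M) ℤ.* t → Mult₂ M (mkℚ n d c)
numerator-multiple M {d = d} t odd-d n≡ = t , d , odd-d , *≡* (cong (ℤ._* + suc d) n≡)

pos-multiple : ∀ M {a} w → a ≡ w * 2 ^ M → + a ≡ + (2 ^ M) ℤ.* + w
pos-multiple M {a} w a≡ = trans (cong +_ (trans a≡ (*-comm w (2 ^ M)))) (ℤP.pos-* (2 ^ M) w)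

≤ν⇒Mult₂ : ∀ M q → M ≤ν q → Mult₂ M q
≤ν⇒Mult₂ M (mkℚ (+ zero) d c) _ =
  + 0 , 0 , %2≢0⇒odd 1 (λ ()) , *≡* (sym (cong (ℤ._* + suc d) (ℤP.*-zeroʳ (+ (2 ^ M)))))
≤ν⇒Mult₂ M (mkℚ (+ suc a) d c) (fin≤fin M≤)
  with valuation⇒odd-denominator M (recompute c) z<s z<s M≤
... | odd-d , divides w a≡ = numerator-multiple M {c = c} (+ w) odd-d (pos-multiple M w a≡)
≤ν⇒Mult₂ M (mkℚ -[1+ a ] d c) (fin≤fin M≤)
  with valuation⇒odd-denominator M (recompute c) z<s z<s M≤
... | odd-d , divides w a≡ = numerator-multiple M {c = c} (ℤ.- + w) odd-d
        (trans (cong ℤ.-_ (pos-multiple M w a≡)) (ℤP.neg-distribʳ-* (+ (2 ^ M)) (+ w)))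

-- 2-adic multiples of 2^M are closed under addition: 2^M·t₁/s₁ + 2^M·t₂/s₂ has
-- numerator 2^M·(t₁s₂ + t₂s₁) and odd denominator s₁s₂.
Mult₂-+ : ∀ {M} p q → Mult₂ M p → Mult₂ M q → Mult₂ M (p ℚ.+ q)
Mult₂-+ {M} p q (t₁ , s₁ , odd-s₁ , p≃) (t₂ , s₂ , odd-s₂ , q≃) =
  t₁ ℤ.* + suc s₂ ℤ.+ t₂ ℤ.* + suc s₁ , s₂ + s₁ * suc s₂ , odd-* odd-s₁ odd-s₂ ,
  ℚᵘP.≃-trans (ℚP.toℚᵘ-homo-+ p q)
    (ℚᵘP.≃-trans (ℚᵘP.+-cong p≃ q≃)
      (ℚᵘP.≃-reflexive (cong (λ z → mkℚᵘ z (s₂ + s₁ * suc s₂)) numerator≡)))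
  where
  P = + (2 ^ M)
  numerator≡ : P ℤ.* t₁ ℤ.* + suc s₂ ℤ.+ P ℤ.* t₂ ℤ.* + suc s₁
             ≡ P ℤ.* (t₁ ℤ.* + suc s₂ ℤ.+ t₂ ℤ.* + suc s₁)
  numerator≡ = trans (cong₂ ℤ._+_ (ℤP.*-assoc P t₁ (+ suc s₂)) (ℤP.*-assoc P t₂ (+ suc s₁)))
                     (sym (ℤP.*-distribˡ-+ P (t₁ ℤ.* + suc s₂) (t₂ ℤ.* + suc s₁)))

ν-ultrametric : ∀ {M} p q → M ≤ν p → M ≤ν q → M ≤ν (p ℚ.+ q)
ν-ultrametric {M} p q M≤p M≤q =
  Mult₂⇒≤ν M (p ℚ.+ q) (Mult₂-+ {M} p q (≤ν⇒Mult₂ M p M≤p) (≤ν⇒Mult₂ M q M≤q))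

ν-neg : ∀ q → ν (ℚ.- q) ≡ ν q
ν-neg (mkℚ (+ zero)  _ _) = refl
ν-neg (mkℚ (+ suc _) _ _) = refl
ν-neg (mkℚ -[1+ _ ]  _ _) = refl

ν-sym : ∀ p q → ν (p - q) ≡ ν (q - p)
ν-sym p q = trans (sym (ν-neg (p - q))) (cong ν (⁻¹-anti-homo‿- p q))

-- An ultrametric Cauchy criterion

telescope : ∀ a b c → (a - b) ℚ.+ (b - c) ≡ a - c
telescope a b c = begin
  (a - b) ℚ.+ (b - c)                 ≡⟨ ℚP.+-assoc a (ℚ.- b) (b - c) ⟩
  a ℚ.+ (ℚ.- b ℚ.+ (b - c))           ≡⟨ cong (a ℚ.+_) (sym (ℚP.+-assoc (ℚ.- b) b (ℚ.- c))) ⟩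
  a ℚ.+ ((ℚ.- b ℚ.+ b) ℚ.+ ℚ.- c)     ≡⟨ cong (λ z → a ℚ.+ (z ℚ.+ ℚ.- c)) (ℚP.+-inverseˡ b) ⟩
  a ℚ.+ (0ℚ ℚ.+ ℚ.- c)                ≡⟨ cong (a ℚ.+_) (ℚP.+-identityˡ (ℚ.- c)) ⟩
  a - c                               ∎
  where open ≡-Reasoning

increments⇒drift : ∀ (F : ℕ → ℚ) M J → (∀ j → J ≤ j → M ≤ν (F (suc j) - F j)) →
                   ∀ m → J ≤ m → ∀ k → M ≤ν (F (k + m) - F m)
increments⇒drift F M J increment m J≤m zero =
  subst (M ≤ν_) (sym (ℚP.+-inverseʳ (F m))) (fin (+ M) ≤∞∞)
increments⇒drift F M J increment m J≤m (suc k) =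
  subst (M ≤ν_) (telescope (F (suc (k + m))) (F (k + m)) (F m))
    (ν-ultrametric _ _ (increment (k + m) (≤-trans J≤m (m≤n+m m k)))
                       (increments⇒drift F M J increment m J≤m k))

increments⇒cauchy : ∀ (F : ℕ → ℚ) M J → (∀ j → J ≤ j → M ≤ν (F (suc j) - F j)) →
                    ∀ m n → J ≤ m → J ≤ n → M ≤ν (F m - F n)
increments⇒cauchy F M J increment m n J≤m J≤n with ≤-total n m
... | inj₁ n≤m = subst (λ i → M ≤ν (F i - F n)) (m∸n+n≡m n≤m)
                   (increments⇒drift F M J increment n J≤n (m ∸ n))
... | inj₂ m≤n = subst (fin (+ M) ≤∞_) (ν-sym (F n) (F m))
                   (subst (λ i → M ≤ν (F i - F m)) (m∸n+n≡m m≤n)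
                     (increments⇒drift F M J increment m J≤m (n ∸ m)))

-- Binary digits of the reductions x_j

bit : Bool → ℕ
bit b = if b then 1 else 0

-- The 2-adic integer (x − x₀)/2: the digits of x with the lowest one removed.
shift : ℤ₂ → ℤ₂
shift x i = x (suc i)

reduce-shift : ∀ x j → reduce x (suc j) ≡ bit (x 0) + 2 * reduce (shift x) j
reduce-shift x zero with x 0
... | true  = refl
... | false = refl
reduce-shift x (suc j) = begin
  reduce x (suc j) + digit (x (suc j)) (suc j)
    ≡⟨ cong (_+ digit (x (suc j)) (suc j)) (reduce-shift x j) ⟩
  bit (x 0) + 2 * reduce (shift x) j + digit (x (suc j)) (suc j)
    ≡⟨ +-assoc (bit (x 0)) _ _ ⟩
  bit (x 0) + (2 * reduce (shift x) j + digit (x (suc j)) (suc j))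
    ≡⟨ cong (λ n → bit (x 0) + n) (double-digit (x (suc j))) ⟩
  bit (x 0) + 2 * reduce (shift x) (suc j) ∎
  where
  open ≡-Reasoning
  digit : Bool → ℕ → ℕ
  digit b i = if b then 2 ^ i else 0
  double-digit : ∀ b → 2 * reduce (shift x) j + digit b (suc j) ≡ 2 * (reduce (shift x) j + digit b j)
  double-digit true  = sym (*-distribˡ-+ 2 (reduce (shift x) j) (2 ^ j))
  double-digit false = sym (*-distribˡ-+ 2 (reduce (shift x) j) 0)

ones-shift : ∀ x j → ones x (suc j) ≡ bit (x 0) + ones (shift x) j
ones-shift x zero with x 0
... | true  = refl
... | false = refl
ones-shift x (suc j) =
  trans (cong (_+ bit (x (suc j))) (ones-shift x j)) (+-assoc (bit (x 0)) (ones (shift x) j) _)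

n+2[1+r] : ∀ n r → n + 2 * suc r ≡ suc (suc (n + 2 * r))
n+2[1+r] = ℕSolver.solve-∀

digit-division : ∀ b r → (bit b + 2 * r) % 2 ≡ bit b × ⌊ bit b + 2 * r /2⌋ ≡ r
digit-division true  zero = refl , refl
digit-division false zero = refl , refl
digit-division b (suc r) rewrite n+2[1+r] (bit b) r
  with digit-division b r
... | rem , half = rem , cong suc half

α-go-step : ∀ fuel b r → α-go (suc fuel) (bit b + 2 * r) ≡ bit b + α-go fuel r
α-go-step fuel b r with digit-division b r
... | rem , half = cong₂ _+_ rem (cong (α-go fuel) half)

-- The binary digit sum of x_j is at most the number of 1's among its j digits
-- (for every amount of fuel: fuel can only cut the count short).
α-reduce≤ones : ∀ fuel x j → α-go fuel (reduce x j) ≤ ones x j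
α-reduce≤ones zero       x j       = z≤n
α-reduce≤ones (suc fuel) x zero    = α-reduce≤ones fuel x zero
α-reduce≤ones (suc fuel) x (suc j) = begin
  α-go (suc fuel) (reduce x (suc j))                  ≡⟨ cong (α-go (suc fuel)) (reduce-shift x j) ⟩
  α-go (suc fuel) (bit (x 0) + 2 * reduce (shift x) j) ≡⟨ α-go-step fuel (x 0) (reduce (shift x) j) ⟩
  bit (x 0) + α-go fuel (reduce (shift x) j)          ≤⟨ +-monoʳ-≤ (bit (x 0)) (α-reduce≤ones fuel (shift x) j) ⟩
  bit (x 0) + ones (shift x) j                        ≡⟨ sym (ones-shift x j) ⟩
  ones x (suc j)                                      ∎
  where open ≤-Reasoning

reduce<2^ : ∀ x j → reduce x j < 2 ^ j
reduce<2^ x zero    = s≤s z≤n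
reduce<2^ x (suc j) = begin-strict
  reduce x j + (if x j then 2 ^ j else 0) ≤⟨ +-monoʳ-≤ (reduce x j) (digit≤ (x j)) ⟩
  reduce x j + 2 ^ j                      <⟨ +-monoˡ-< (2 ^ j) (reduce<2^ x j) ⟩
  2 ^ j + 2 ^ j                           ≡⟨ cong (λ n → 2 ^ j + n) (sym (+-identityʳ (2 ^ j))) ⟩
  2 ^ suc j                               ∎
  where
  open ≤-Reasoning
  digit≤ : ∀ b → (if b then 2 ^ j else 0) ≤ 2 ^ j
  digit≤ true  = ≤-refl
  digit≤ false = z≤n

zeros+ones≡length : ∀ x j → zeros x j + ones x j ≡ j
zeros+ones≡length x zero = refl
zeros+ones≡length x (suc j) with x j
... | true  = trans (count-one (zeros x j) (ones x j)) (cong suc (zeros+ones≡length x j))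
  where
  count-one : ∀ z o → z + 0 + (o + 1) ≡ suc (z + o)
  count-one = ℕSolver.solve-∀
... | false = trans (count-zero (zeros x j) (ones x j)) (cong suc (zeros+ones≡length x j))
  where
  count-zero : ∀ z o → z + 1 + (o + 0) ≡ suc (z + o)
  count-zero = ℕSolver.solve-∀

-- Valuation bounds for the increments of f(x_j)

Hypothesis : Set
Hypothesis = (e k : ℕ) → k < 2 ^ e →
  fin (+ e ℤ.- + (2 * α k) ℤ.- + 2) ≤∞ ν (f (2 ^ e ℕ.+ k) - f k)

≤∞-weaken : ∀ {M z w} → + M ℤ.≤ z → fin z ≤∞ w → fin (+ M) ≤∞ w
≤∞-weaken M≤z (fin≤fin z≤w) = fin≤fin (ℤP.≤-trans M≤z z≤w)
≤∞-weaken {M} _ (_ ≤∞∞) = fin (+ M) ≤∞∞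

exponent-bound : ∀ M z o a → + (M + 2) ℤ.≤ + z ℤ.- + o → a ≤ o →
                 + M ℤ.≤ + (z + o) ℤ.- + (2 * a) ℤ.- + 2
exponent-bound M z o a gap a≤o = begin
  + M                                ≡⟨ add-sub (+ M) (+ 2) ⟩
  + M ℤ.+ + 2 ℤ.- + 2                ≡⟨ cong (ℤ._- + 2) (sym (ℤP.pos-+ M 2)) ⟩
  + (M + 2) ℤ.- + 2                  ≤⟨ ℤP.+-monoˡ-≤ (ℤ.- + 2) gap ⟩
  + z ℤ.- + o ℤ.- + 2                ≡⟨ cong (ℤ._- + 2) (sym difference) ⟩
  + (z + o) ℤ.- + (2 * o) ℤ.- + 2    ≤⟨ ℤP.+-monoˡ-≤ (ℤ.- + 2) (ℤP.+-monoʳ-≤ (+ (z + o))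
                                          (ℤP.neg-mono-≤ (+≤+ (*-monoʳ-≤ 2 a≤o)))) ⟩
  + (z + o) ℤ.- + (2 * a) ℤ.- + 2    ∎
  where
  open ℤP.≤-Reasoning
  add-sub : ∀ m n → m ≡ m ℤ.+ n ℤ.- n
  add-sub = ℤSolver.solve-∀
  cancel-o : ∀ z o → z ℤ.+ o ℤ.- + 2 ℤ.* o ≡ z ℤ.- o
  cancel-o = ℤSolver.solve-∀
  difference : + (z + o) ℤ.- + (2 * o) ≡ + z ℤ.- + o
  difference = trans (cong₂ (λ p q → p ℤ.- q) (ℤP.pos-+ z o) (ℤP.pos-* 2 o)) (cancel-o (+ z) (+ o))

increment-bound : Hypothesis → ∀ M x j → + (M + 2) ℤ.≤ + zeros x j ℤ.- + ones x j →
                  M ≤ν (f (reduce x (suc j)) - f (reduce x j))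
increment-bound H M x j gap with x j
... | false = subst (λ r → M ≤ν (f r - f (reduce x j))) (sym (+-identityʳ (reduce x j)))
                (subst (M ≤ν_) (sym (ℚP.+-inverseʳ (f (reduce x j)))) (fin (+ M) ≤∞∞))
... | true  = subst (λ r → M ≤ν (f r - f (reduce x j))) (+-comm (2 ^ j) (reduce x j))
                (≤∞-weaken bound (H j (reduce x j) (reduce<2^ x j)))
  where
  bound : + M ℤ.≤ + j ℤ.- + (2 * α (reduce x j)) ℤ.- + 2
  bound = subst (λ n → + M ℤ.≤ + n ℤ.- + (2 * α (reduce x j)) ℤ.- + 2) (zeros+ones≡length x j)
            (exponent-bound M (zeros x j) (ones x j) (α (reduce x j)) gap
              (α-reduce≤ones (reduce x j) x j))

-- The theorem: if (#0's − #1's) in x_j tends to ∞, the sequence f(x_j) is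
-- 2-adically Cauchy, i.e. f(x) is 2-definable.
proposition1p3 :
    ((e k : ℕ) → k < 2 ^ e →
      fin (+ e ℤ.- + (2 * α k) ℤ.- + 2) ≤∞ ν (f (2 ^ e ℕ.+ k) - f k)) →
    (x : ℤ₂) →
    ((M : ℕ) → ∃[ J ] ((j : ℕ) → J ≤ j → + M ℤ.≤ + zeros x j ℤ.- + ones x j)) →
    (M : ℕ) → ∃[ N ] ((m n : ℕ) → N ≤ m → N ≤ n →
      fin (+ M) ≤∞ ν (f (reduce x m) - f (reduce x n)))
proposition1p3 H x zeros-dominate M with zeros-dominate (M + 2)
... | J , gap = J , increments⇒cauchy (λ j → f (reduce x j)) M J
                      (λ j J≤j → increment-bound H M x j (gap j J≤j))
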